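{- Let $B,B'$ be labeled terms, $x$ a variable, $a$ a label, $S$ a finite sequence of variables and $k\ge0$. (1) If $B \rightsquigarrow_{x\cdot S,0} B'$, then $\lambda^a x.B \rightsquigarrow_{S,0}\lambda^a x.B'$. (2) If $B\rightsquigarrow_{S,k}B'$, then $\lambda^a x.B\rightsquigarrow_{S,k+1}\lambda^a x.B'$.
   Context: Labeled terms: $A ::= x \mid \lambda^a x.A \mid A\,@^a A$ with labels from a countably infinite set containing a distinguished never-bound label $\star$; in $A\,@^a B$ the label $a$ binds the occurrences of $a$ in $A$. $A[x:=B]$ is substitution capturing neither variables nor labels; $A[a:=\star]$ replaces free occurrences of $a$ by $\star$. For a context $C$, $\mathrm{bPath}(C)$ is the sequence of variables bound above the hole; a term is away from a sequence $S$ if none of its free variables occur in $S$; $x\cdot S$ prepends $x$, $\oplus$ concatenates. Reduction: $C[(\lambda^a x.A)\,@^a B]\to_S C[A[a:=\star][x:=B]]$ whenever $(\lambda^a x.A)\,@^a B$ is away from $\mathrm{bPath}(C)\oplus S$; $\twoheadrightarrow_S$ is its reflexive–transitive closure. Chain reduction $\rightsquigarrow_{S,k}$ is defined by induction on $k$: $A\rightsquigarrow_{S,0}B$ iff $A\twoheadrightarrow_S B$; $A\rightsquigarrow_{S,k+1}B$ iff there exist $x$, $a$, $A_1,A_2$ with $A\twoheadrightarrow_S\lambda^a x.A_1$, $A_1\rightsquigarrow_{S,k}A_2$ and $B=\lambda^a x.A_2$. -}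

module Defs where

open import Data.Nat using (ℕ; zero; suc; _⊔_; _≟_; _≡ᵇ_)
open import Data.List using (List; []; _∷_; _++_; filter; foldr; concatMap)
open import Data.List.Membership.Propositional using (_∈_; _∉_)
open import Data.List.Membership.DecPropositional _≟_ using (_∈?_)
open import Data.Bool using (if_then_else_)
open import Data.Product using (Σ; _×_; ∃-syntax)
open import Relation.Nullary.Decidable using (¬?; does)
open import Relation.Binary.PropositionalEquality using (_≡_)
open import Relation.Binary.Construct.Closure.ReflexiveTransitive using (Star)

Var : Set
Var = ℕ

-- Labels: the distinguished never-bound label ★, and ordinary labels.
data Label : Set where
  ★   : Label
  lab : ℕ → Label

data Term : Set where
  var : Var → Term
  lam : Label → Var → Term → Term
  app : Label → Term → Term → Term     -- app a A B  =  A @^a B  (a binds in A)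

labs : Label → List ℕ
labs ★       = []
labs (lab n) = n ∷ []

remove : ℕ → List ℕ → List ℕ
remove y = filter (λ z → ¬? (z ≟ y))

fv : Term → List Var
fv (var x)     = x ∷ []
fv (lam _ y A) = remove y (fv A)
fv (app _ A B) = fv A ++ fv B

-- free labels (★ is never bound and is not recorded)
fl : Term → List ℕ
fl (var _)           = []
fl (lam l _ A)       = labs l ++ fl A
fl (app ★ A B)       = fl A ++ fl B
fl (app (lab a) A B) = remove a (fl A) ++ fl B

fresh : List ℕ → ℕ
fresh xs = suc (foldr _⊔_ 0 xs)

choose : ℕ → List ℕ → ℕ
choose y avoid = if does (y ∈? avoid) then fresh avoid else y

applyL : (ℕ → Label) → Label → Label
applyL ρ ★       = ★
applyL ρ (lab n) = ρ n

-- simultaneous, capture-avoiding substitution of terms for variables (σ)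
-- and of labels for labels (ρ); bound variables / labels are renamed only
-- when necessary to avoid capture.
subst : (Var → Term) → (ℕ → Label) → Term → Term
subst σ ρ (var x) = σ x
subst σ ρ (lam l y A) =
  let z = choose y (concatMap (λ w → fv (σ w)) (remove y (fv A)))
  in lam (applyL ρ l) z (subst (λ w → if w ≡ᵇ y then var z else σ w) ρ A)
subst σ ρ (app ★ A B) = app ★ (subst σ ρ A) (subst σ ρ B)
subst σ ρ (app (lab a) A B) =
  let b = choose a (concatMap (λ w → fl (σ w)) (fv A)
                    ++ concatMap (λ c → labs (ρ c)) (remove a (fl A)))
  in app (lab b) (subst σ (λ c → if c ≡ᵇ a then lab b else ρ c) A) (subst σ ρ B)

_[_:=_] : Term → Var → Term → Term
A [ x := B ] = subst (λ w → if w ≡ᵇ x then B else var w) lab A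

_[_:=★] : Term → ℕ → Term
A [ a :=★] = subst var (λ c → if c ≡ᵇ a then ★ else lab c) A

-- A[a:=★] for an arbitrary label a (★[★:=★] changes nothing)
labStar : Term → Label → Term
labStar A ★       = A
labStar A (lab a) = A [ a :=★]

data Ctx : Set where
  hole : Ctx
  lamC : Label → Var → Ctx → Ctx
  appL : Label → Ctx → Term → Ctx
  appR : Label → Term → Ctx → Ctx

plug : Ctx → Term → Term
plug hole         T = T
plug (lamC a x C) T = lam a x (plug C T)
plug (appL a C B) T = app a (plug C T) B
plug (appR a A C) T = app a A (plug C T)

-- variables bound above the hole (outermost first)
bPath : Ctx → List Var
bPath hole         = []
bPath (lamC _ x C) = x ∷ bPath C
bPath (appL _ C _) = bPath C
bPath (appR _ _ C) = bPath C

Away : Term → List Var → Set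
Away A S = ∀ v → v ∈ fv A → v ∉ S

data Step (S : List Var) : Term → Term → Set where
  β : (C : Ctx) (a : Label) (x : Var) (A B : Term) →
      Away (app a (lam a x A) B) (bPath C ++ S) →
      Step S (plug C (app a (lam a x A) B)) (plug C ((labStar A a) [ x := B ]))

Steps : List Var → Term → Term → Set
Steps S = Star (Step S)

Chain : List Var → ℕ → Term → Term → Set
Chain S zero    A B = Steps S A B
Chain S (suc k) A B =
  ∃[ x ] ∃[ a ] ∃[ A₁ ] ∃[ A₂ ]
    (Steps S A (lam a x A₁) × Chain S k A₁ A₂ × B ≡ lam a x A₂)

module Submission where

open import Defs
open import Data.Nat using (ℕ; suc)
open import Data.List using (List; _∷_; _++_)
open import Data.List.Membership.Propositional using (_∈_)
open import Data.List.Relation.Binary.Permutation.Propositional using (↭-sym)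
open import Data.List.Relation.Binary.Permutation.Propositional.Properties using (shift; ∈-resp-↭)
open import Data.Product using (_×_; _,_)
open import Relation.Binary.PropositionalEquality using (refl)
open import Relation.Binary.Construct.Closure.ReflexiveTransitive using (ε; gmap)

∈-cons-++⇒∈-++-cons : ∀ {A : Set} {v x : A} (P S : List A) →
                      v ∈ x ∷ P ++ S → v ∈ P ++ x ∷ S
∈-cons-++⇒∈-++-cons {x = x} P S = ∈-resp-↭ (↭-sym (shift x P S))

-- Going under λ x extends the bound path of the redex's context by x, which
-- is exactly the variable moved from the avoidance list into the context.
Step-lam : ∀ {S M N} x a → Step (x ∷ S) M N → Step S (lam a x M) (lam a x N)
Step-lam {S} x a (β C b y A B away) =
  β (lamC a x C) b y A B
    (λ v v∈fv v∈path → away v v∈fv (∈-cons-++⇒∈-++-cons (bPath C) S v∈path))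

Steps-lam : ∀ {S M N} x a → Steps (x ∷ S) M N → Steps S (lam a x M) (lam a x N)
Steps-lam x a = gmap (lam a x) (Step-lam x a)

Chain-lam : ∀ {S k M N} x a → Chain S k M N → Chain S (suc k) (lam a x M) (lam a x N)
Chain-lam {M = M} {N} x a chain = x , a , M , N , ε , chain , refl

mainTheorem7 : (B B′ : Term) (x : Var) (a : Label) (S : List Var) (k : ℕ) →
    (Chain (x ∷ S) 0 B B′ → Chain S 0 (lam a x B) (lam a x B′))
    × (Chain S k B B′ → Chain S (suc k) (lam a x B) (lam a x B′))
mainTheorem7 B B′ x a S k = Steps-lam x a , Chain-lam x a
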